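{- Let $G$ be a graph with $V(G)=\{v_1,\dots,v_n\}$, let $m\in\mathbb{N}$, let $d_1,\dots,d_n$ be nonnegative integers, and let $L$ be a list assignment for $G$ with $|L(v_i)|=m+d_i$ for each $i$. Then \[P(G,L)\ge\left\lceil\frac{P_\ell(G,m)\prod_{i=1}^n(m+d_i)}{m^n}\right\rceil.\]
   Context: For a list assignment $L$, $P(G,L)$ is the number of proper colorings $f$ with $f(v)\in L(v)$ for all $v$; $P_\ell(G,m)$ is the minimum of $P(G,L)$ over all list assignments with all lists of size $m$. -}

module Defs where

open import Data.Nat using (ℕ; zero; suc; _+_; _*_; _∸_; _^_; _/_; _≤_; _≡ᵇ_; NonZero)
open import Data.Nat.Properties using (m^n≢0)
open import Data.Bool using (Bool; true; false; _∧_; not)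
open import Data.Fin using (Fin; zero; suc)
open import Data.Vec using (Vec; []; _∷_; lookup)
open import Data.List using (List; []; _∷_; [_]; length; filterᵇ; cartesianProductWith; allFin; map; concatMap)
open import Data.Bool.ListAction using (and)
open import Data.Nat.ListAction using (product)
open import Data.List.Relation.Unary.Unique.Propositional using (Unique)
open import Data.Product using (Σ; _×_; _,_)
open import Relation.Binary.PropositionalEquality using (_≡_)
open import Function using (_∘_)

record Graph (n : ℕ) : Set where
  field
    adj      : Fin n → Fin n → Bool
    adj-sym  : ∀ i j → adj i j ≡ adj j i
    loopless : ∀ i → adj i i ≡ false
open Graph public

-- A list assignment: each vertex gets a finite list of colours (colours are
-- natural numbers); lists are duplicate-free, so |L(v)| = length (L v).
record ListAssignment (n : ℕ) : Set where
  field
    lists    : Fin n → List ℕ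
    distinct : ∀ i → Unique (lists i)
open ListAssignment public

-- All maps f with f(v_i) ∈ L(v_i), each exactly once, as vectors of colours.
choices : ∀ {n} → (Fin n → List ℕ) → List (Vec ℕ n)
choices {zero}  L = [ [] ]
choices {suc n} L = cartesianProductWith _∷_ (L zero) (choices (L ∘ suc))

isProper : ∀ {n} → Graph n → Vec ℕ n → Bool
isProper {n} G f =
  and (concatMap (λ i → map (λ j → not (adj G i j ∧ (lookup f i ≡ᵇ lookup f j))) (allFin n)) (allFin n))

P : ∀ {n} → Graph n → ListAssignment n → ℕ
P G L = length (filterᵇ (isProper G) (choices (lists L)))

IsMAssignment : ∀ {n} → ℕ → ListAssignment n → Set
IsMAssignment m L = ∀ i → length (lists L i) ≡ m

-- k = P_ℓ(G,m): k is the minimum of P(G,L) over all m-assignments L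
-- (attained, and a lower bound for all of them).
IsListColorFunctionValue : ∀ {n} → Graph n → ℕ → ℕ → Set
IsListColorFunctionValue G m k =
  (Σ (ListAssignment _) λ L → IsMAssignment m L × P G L ≡ k)
  × (∀ L → IsMAssignment m L → k ≤ P G L)

∏ : ∀ {n} → (Fin n → ℕ) → ℕ
∏ {n} a = product (map a (allFin n))

⌈_/_⌉ : (a b : ℕ) → .{{NonZero b}} → ℕ
⌈ a / b ⌉ = (a + (b ∸ 1)) / b

{-# OPTIONS --safe #-}
module Submission where

-- Deleting one colour from the list of a vertex with ℓ ≥ 2 colours, in each of the ℓ possible
-- ways, loses every L-colouring in exactly one of them: the colouring counts of the ℓ smaller
-- assignments add up to (ℓ - 1) P(G,L), while each of their list-size products is (ℓ - 1)/ℓ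
-- times that of L.  So the ratio bound P(G,L) / ∏ |L(v_i)| ≥ P_ℓ(G,m) / m^n passes from the
-- smaller assignments to L, and induction on the total list size reduces it to m-assignments,
-- where it is the definition of P_ℓ(G,m).

open import Defs
open import Algebra.Bundles using (CommutativeMonoid)
import Algebra.Properties.CommutativeMonoid.Sum as MonoidSum
import Algebra.Properties.CommutativeSemigroup as CommutativeSemigroupProperties
open import Data.Bool using (Bool; true; false)
open import Data.Fin using (Fin; zero; suc)
open import Data.Fin.Properties using (all?; ¬∀⟶∃¬)
open import Data.List using (List; []; _∷_; length; map; lookup; removeAt; filterᵇ; cartesianProductWith; tabulate)
open import Data.List.Properties using (filter-++; length-++; length-removeAt; length-removeAt′; map-tabulate)
open import Data.List.Relation.Unary.All using (All; _∷_)
open import Data.List.Relation.Unary.AllPairs using (AllPairs; _∷_)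
open import Data.List.Relation.Unary.Unique.Propositional using (Unique)
open import Data.Nat using (ℕ; zero; suc; pred; _+_; _*_; _^_; _≤_; _<_; NonZero; >-nonZero; >-nonZero⁻¹; s≤s⁻¹)
open import Data.Nat.ListAction using (product)
open import Data.Nat.DivMod using (m<n*o⇒m/o<n)
open import Data.Nat.Induction using (<-wellFounded)
open import Data.Nat.Properties
open import Algebra.Properties.Semiring.Sum +-*-semiring using (sum-syntax; sum-cong-≗; ∑-comm; ∑-distrib-+; *-distribˡ-sum)
open import Data.Product using (_,_)
open import Data.Vec using (Vec; _∷_)
open import Data.Vec.Functional using (Vector; head; tail; updateAt)
open import Data.Vec.Functional.Properties using (map-updateAt-local)
open import Function using (_∘_; const; id)
open import Induction.WellFounded using (Acc; acc)
open import Relation.Binary.PropositionalEquality using (_≡_; refl; sym; trans; cong; cong₂; subst; module ≡-Reasoning)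
open import Relation.Nullary using (yes; no)

open MonoidSum *-1-commutativeMonoid using () renaming (sum to ∏ᶠ; sum-cong-≗ to ∏ᶠ-cong)
open CommutativeSemigroupProperties *-commutativeSemigroup using (x∙yz≈y∙xz)

module _ {c ℓ} (M : CommutativeMonoid c ℓ) where
  open CommutativeMonoid M
  open MonoidSum M using (sum)
  open CommutativeSemigroupProperties commutativeSemigroup using () renaming (x∙yz≈y∙xz to swap)
  open import Relation.Binary.Reasoning.Setoid setoid

  sum-updateAt : ∀ {n} (t : Vector Carrier n) i x → t i ∙ sum (updateAt t i (const x)) ≈ x ∙ sum t
  sum-updateAt t zero    x = swap (head t) x _
  sum-updateAt t (suc i) x = begin
    t (suc i) ∙ (head t ∙ sum (updateAt (tail t) i (const x))) ≈⟨ swap _ _ _ ⟩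
    head t ∙ (t (suc i) ∙ sum (updateAt (tail t) i (const x))) ≈⟨ ∙-congˡ (sum-updateAt (tail t) i x) ⟩
    head t ∙ (x ∙ sum (tail t))                                ≈⟨ swap _ _ _ ⟩
    x ∙ (head t ∙ sum (tail t))                                ∎

∑-const : ∀ n x → ∑[ i < n ] x ≡ n * x
∑-const zero    x = refl
∑-const (suc n) x = cong (x +_) (∑-const n x)

∑-mono-≤ : ∀ {n} {f g : Fin n → ℕ} → (∀ i → f i ≤ g i) → ∑[ i < n ] f i ≤ ∑[ i < n ] g i
∑-mono-≤ {zero}  f≤g = ≤-refl
∑-mono-≤ {suc n} f≤g = +-mono-≤ (f≤g zero) (∑-mono-≤ (f≤g ∘ suc))

∏ᶠ-const : ∀ n m → ∏ᶠ {n} (const m) ≡ m ^ n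
∏ᶠ-const zero    m = refl
∏ᶠ-const (suc n) m = cong (m *_) (∏ᶠ-const n m)

∏≡∏ᶠ : ∀ {n} (f : Fin n → ℕ) → ∏ f ≡ ∏ᶠ f
∏≡∏ᶠ f = trans (cong product (map-tabulate id f)) (product-tabulate f)
  where
  product-tabulate : ∀ {n} (f : Fin n → ℕ) → product (tabulate f) ≡ ∏ᶠ f
  product-tabulate {zero}  f = refl
  product-tabulate {suc n} f = cong (f zero *_) (product-tabulate (f ∘ suc))

⌈/⌉-≤ : ∀ {a b c} .{{_ : NonZero b}} → a ≤ b * c → ⌈ a / b ⌉ ≤ c
⌈/⌉-≤ {a} {b@(suc b-1)} {c} a≤bc = s≤s⁻¹ (m<n*o⇒m/o<n (begin-strict
    a + b-1    <⟨ +-mono-≤-< a≤bc (n<1+n b-1) ⟩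
    b * c + b  ≡⟨ +-comm (b * c) b ⟩
    b + b * c  ≡⟨ cong (b +_) (*-comm b c) ⟩
    suc c * b  ∎))
  where open ≤-Reasoning

∑-lookup-removeAt : ∀ {A : Set} (g : A → ℕ) (xs : List A) (j : Fin (length xs)) →
  ∑[ i < length (removeAt xs j) ] g (lookup (removeAt xs j) i) + g (lookup xs j)
    ≡ ∑[ i < length xs ] g (lookup xs i)
∑-lookup-removeAt g (x ∷ xs) zero    = +-comm _ (g x)
∑-lookup-removeAt g (x ∷ xs) (suc j) = trans (+-assoc (g x) _ _) (cong (g x +_) (∑-lookup-removeAt g xs j))

∑-∑-lookup-removeAt : ∀ {A : Set} (g : A → ℕ) (xs : List A) →
  ∑[ j < length xs ] ∑[ i < length (removeAt xs j) ] g (lookup (removeAt xs j) i)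
    ≡ pred (length xs) * ∑[ i < length xs ] g (lookup xs i)
∑-∑-lookup-removeAt g []       = refl
∑-∑-lookup-removeAt g (x ∷ xs) = +-cancelʳ-≡ S _ _ (begin
    ∑[ j < ℓ ] R j + S                       ≡⟨ ∑-distrib-+ R (g ∘ lookup (x ∷ xs)) ⟨
    ∑[ j < ℓ ] (R j + g (lookup (x ∷ xs) j)) ≡⟨ sum-cong-≗ (∑-lookup-removeAt g (x ∷ xs)) ⟩
    ∑[ j < ℓ ] S                             ≡⟨ ∑-const ℓ S ⟩
    S + length xs * S                        ≡⟨ +-comm S _ ⟩
    length xs * S + S                        ∎)
  where
  open ≡-Reasoning
  ℓ = suc (length xs)
  S = ∑[ i < ℓ ] g (lookup (x ∷ xs) i)
  R : Fin ℓ → ℕ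
  R j = ∑[ i < length (removeAt (x ∷ xs) j) ] g (lookup (removeAt (x ∷ xs) j) i)

AllPairs-removeAt : ∀ {A : Set} {R : A → A → Set} {xs : List A} →
  AllPairs R xs → (j : Fin (length xs)) → AllPairs R (removeAt xs j)
AllPairs-removeAt (_ ∷ rxs) zero    = rxs
AllPairs-removeAt (rx ∷ rxs) (suc j) = All-removeAt rx j ∷ AllPairs-removeAt rxs j
  where
  All-removeAt : ∀ {A : Set} {P : A → Set} {xs : List A} → All P xs → (j : Fin (length xs)) → All P (removeAt xs j)
  All-removeAt (_ ∷ pxs) zero    = pxs
  All-removeAt (px ∷ pxs) (suc j) = px ∷ All-removeAt pxs j

updateAt⁺ : ∀ {n} {A : Set} (P : A → Set) (t : Vector A n) v {x} →
  (∀ i → P (t i)) → P x → ∀ i → P (updateAt t v (const x) i)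
updateAt⁺ P t zero    pt px zero    = px
updateAt⁺ P t zero    pt px (suc i) = pt (suc i)
updateAt⁺ P t (suc v) pt px zero    = pt zero
updateAt⁺ P t (suc v) pt px (suc i) = updateAt⁺ P (tail t) v (pt ∘ suc) px i

removeColour : ∀ {n} {A : Set} (L : Fin n → List A) (v : Fin n) → Fin (length (L v)) → Fin n → List A
removeColour L v j = updateAt L v (const (removeAt (L v) j))

length-removeColour : ∀ {n} {A : Set} (L : Fin n → List A) v j i →
  length (removeColour L v j i) ≡ updateAt (length ∘ L) v (const (pred (length (L v)))) i
length-removeColour L v j = map-updateAt-local {f = length} L v (length-removeAt (L v) j)

size : ∀ {n} {A : Set} → (Fin n → List A) → ℕ
size {n} L = ∑[ i < n ] length (L i)

size-removeColour : ∀ {n} {A : Set} (L : Fin n → List A) v j → size (removeColour L v j) < size L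
size-removeColour L v j = ≤-reflexive (+-cancelˡ-≡ s _ _ (begin
    s + suc (size (removeColour L v j))
      ≡⟨ +-suc s _ ⟩
    suc s + size (removeColour L v j)
      ≡⟨ cong₂ _+_ (sym ℓ≡1+s) (sum-cong-≗ (length-removeColour L v j)) ⟩
    length (L v) + ∑[ i < _ ] updateAt (length ∘ L) v (const s) i
      ≡⟨ sum-updateAt +-0-commutativeMonoid (length ∘ L) v s ⟩
    s + size L ∎))
  where
  open ≡-Reasoning
  s = pred (length (L v))
  ℓ≡1+s : length (L v) ≡ suc s
  ℓ≡1+s = trans (length-removeAt′ (L v) j) (cong suc (length-removeAt (L v) j))

count : ∀ {n} → (Vec ℕ n → Bool) → (Fin n → List ℕ) → ℕ
count q L = length (filterᵇ q (choices L))

length-filterᵇ-map : ∀ {A B : Set} (p : B → Bool) (f : A → B) (xs : List A) →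
  length (filterᵇ p (map f xs)) ≡ length (filterᵇ (p ∘ f) xs)
length-filterᵇ-map p f []       = refl
length-filterᵇ-map p f (x ∷ xs) with p (f x)
... | true  = cong suc (length-filterᵇ-map p f xs)
... | false = length-filterᵇ-map p f xs

count-suc : ∀ {n} (q : Vec ℕ (suc n) → Bool) (L : Fin (suc n) → List ℕ) →
  count q L ≡ ∑[ i < length (L zero) ] count (q ∘ (lookup (L zero) i ∷_)) (L ∘ suc)
count-suc q L = go (L zero)
  where
  ys = choices (L ∘ suc)
  go : ∀ xs → length (filterᵇ q (cartesianProductWith _∷_ xs ys))
              ≡ ∑[ i < length xs ] length (filterᵇ (q ∘ (lookup xs i ∷_)) ys)
  go []       = refl
  go (x ∷ xs) = trans (cong length (filter-++ _ (map (x ∷_) ys) _))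
                (trans (length-++ (filterᵇ q (map (x ∷_) ys)))
                       (cong₂ _+_ (length-filterᵇ-map q (x ∷_) ys) (go xs)))

∑-count-removeColour : ∀ {n} (q : Vec ℕ n → Bool) (L : Fin n → List ℕ) v →
  ∑[ j < length (L v) ] count q (removeColour L v j) ≡ pred (length (L v)) * count q L
∑-count-removeColour q L zero = begin
    ∑[ j < length l ] count q (removeColour L zero j)
      ≡⟨ sum-cong-≗ (λ j → count-suc q (removeColour L zero j)) ⟩
    ∑[ j < length l ] ∑[ i < length (removeAt l j) ] c (lookup (removeAt l j) i)
      ≡⟨ ∑-∑-lookup-removeAt c l ⟩
    pred (length l) * ∑[ i < length l ] c (lookup l i)
      ≡⟨ cong (pred (length l) *_) (count-suc q L) ⟨
    pred (length l) * count q L ∎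
  where
  open ≡-Reasoning
  l = L zero
  c : ℕ → ℕ
  c x = count (q ∘ (x ∷_)) (L ∘ suc)
∑-count-removeColour q L (suc w) = begin
    ∑[ j < ℓ ] count q (removeColour L (suc w) j)
      ≡⟨ sum-cong-≗ (λ j → count-suc q (removeColour L (suc w) j)) ⟩
    ∑[ j < ℓ ] ∑[ i < length (L zero) ] h i j
      ≡⟨ ∑-comm (λ j i → h i j) ⟩
    ∑[ i < length (L zero) ] ∑[ j < ℓ ] h i j
      ≡⟨ sum-cong-≗ (λ i → ∑-count-removeColour (q ∘ (lookup (L zero) i ∷_)) (L ∘ suc) w) ⟩
    ∑[ i < length (L zero) ] (pred ℓ * c i)
      ≡⟨ *-distribˡ-sum (pred ℓ) c ⟨
    pred ℓ * ∑[ i < length (L zero) ] c i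
      ≡⟨ cong (pred ℓ *_) (count-suc q L) ⟨
    pred ℓ * count q L ∎
  where
  open ≡-Reasoning
  ℓ = length (L (suc w))
  c : Fin (length (L zero)) → ℕ
  c i = count (q ∘ (lookup (L zero) i ∷_)) (L ∘ suc)
  h : Fin (length (L zero)) → Fin ℓ → ℕ
  h i j = count (q ∘ (lookup (L zero) i ∷_)) (removeColour (L ∘ suc) w j)

module _ {n} (q : Vec ℕ n → Bool) (m k : ℕ) .{{_ : NonZero m}}
         (k≤count : ∀ L → IsMAssignment m L → k ≤ count q (lists L)) where

  Bound : (Fin n → List ℕ) → Set
  Bound L = k * ∏ᶠ (length ∘ L) ≤ m ^ n * count q L

  bound-base : ∀ L → (∀ i → Unique (L i)) → (∀ i → length (L i) ≡ m) → Bound L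
  bound-base L U |L|≡m = begin
    k * ∏ᶠ (length ∘ L) ≡⟨ cong (k *_) (trans (∏ᶠ-cong |L|≡m) (∏ᶠ-const n m)) ⟩
    k * m ^ n          ≡⟨ *-comm k _ ⟩
    m ^ n * k          ≤⟨ *-monoʳ-≤ (m ^ n) (k≤count (record { lists = L ; distinct = U }) |L|≡m) ⟩
    m ^ n * count q L  ∎
    where open ≤-Reasoning

  bound-step : ∀ L v → m < length (L v) → (∀ j → Bound (removeColour L v j)) → Bound L
  bound-step L v m<ℓ bound-removeColour = *-cancelˡ-≤ s {{s≢0}} (begin
    s * (k * Π)                     ≡⟨ x∙yz≈y∙xz s k Π ⟩
    k * (s * Π)                     ≡⟨ cong (k *_) (sum-updateAt *-1-commutativeMonoid (length ∘ L) v s) ⟨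
    k * (ℓ * Π′)                    ≡⟨ x∙yz≈y∙xz k ℓ Π′ ⟩
    ℓ * (k * Π′)                    ≡⟨ ∑-const ℓ (k * Π′) ⟨
    ∑[ j < ℓ ] (k * Π′)             ≤⟨ ∑-mono-≤ bound-removeColour′ ⟩
    ∑[ j < ℓ ] (m ^ n * C j)        ≡⟨ *-distribˡ-sum (m ^ n) C ⟨
    m ^ n * ∑[ j < ℓ ] C j          ≡⟨ cong (m ^ n *_) (∑-count-removeColour q L v) ⟩
    m ^ n * (s * count q L)         ≡⟨ x∙yz≈y∙xz (m ^ n) s _ ⟩
    s * (m ^ n * count q L)         ∎)
    where
    open ≤-Reasoning
    ℓ = length (L v)
    s = pred ℓ
    s≢0 : NonZero s
    s≢0 = >-nonZero (≤-trans (>-nonZero⁻¹ m) (<⇒≤pred m<ℓ))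
    Π = ∏ᶠ (length ∘ L)
    Π′ = ∏ᶠ (updateAt (length ∘ L) v (const s))
    C : Fin ℓ → ℕ
    C j = count q (removeColour L v j)
    bound-removeColour′ : ∀ j → k * Π′ ≤ m ^ n * C j
    bound-removeColour′ j = subst (λ p → k * p ≤ m ^ n * C j)
      (∏ᶠ-cong (length-removeColour L v j)) (bound-removeColour j)

  bound-acc : ∀ L → Acc _<_ (size L) → (∀ i → Unique (L i)) → (∀ i → m ≤ length (L i)) → Bound L
  bound-acc L (acc smaller) U m≤ with all? (λ i → length (L i) ≟ m)
  ... | yes |L|≡m = bound-base L U |L|≡m
  ... | no ¬|L|≡m =
    let (v , ℓ≢m) = ¬∀⟶∃¬ n _ (λ i → length (L i) ≟ m) ¬|L|≡m
        m<ℓ = ≤∧≢⇒< (m≤ v) (ℓ≢m ∘ sym)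
    in bound-step L v m<ℓ λ j →
         bound-acc (removeColour L v j) (smaller (size-removeColour L v j))
           (updateAt⁺ Unique L v U (AllPairs-removeAt (U v) j))
           (λ i → subst (m ≤_) (sym (length-removeColour L v j i))
                    (updateAt⁺ (m ≤_) (length ∘ L) v m≤ (<⇒≤pred m<ℓ) i))

  count-lowerBound : ∀ L → (∀ i → Unique (L i)) → (∀ i → m ≤ length (L i)) →
    k * ∏ᶠ (length ∘ L) ≤ m ^ n * count q L
  count-lowerBound L = bound-acc L (<-wellFounded (size L))

mainTheorem16 : (n : ℕ) (G : Graph n) (m : ℕ) .{{_ : NonZero m}} (d : Fin n → ℕ)
    (L : ListAssignment n) → (∀ i → length (lists L i) ≡ m + d i) →
    (k : ℕ) → IsListColorFunctionValue G m k →
    ⌈_/_⌉ (k * ∏ (λ i → m + d i)) (m ^ n) {{m^n≢0 m n}} ≤ P G L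
mainTheorem16 n G m d L |L|≡m+d k (_ , k≤P) = ⌈/⌉-≤ {{m^n≢0 m n}} (begin
    k * ∏ (λ i → m + d i)      ≡⟨ cong (k *_) (trans (∏≡∏ᶠ {n} (λ i → m + d i)) (∏ᶠ-cong (sym ∘ |L|≡m+d))) ⟩
    k * ∏ᶠ (length ∘ lists L)  ≤⟨ count-lowerBound (isProper G) m k k≤P (lists L) (distinct L) m≤|L| ⟩
    m ^ n * P G L              ∎)
  where
  open ≤-Reasoning
  m≤|L| : ∀ i → m ≤ length (lists L i)
  m≤|L| i = subst (m ≤_) (sym (|L|≡m+d i)) (m≤m+n m (d i))
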